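{- Let $n,a,b$ be natural numbers and $k\ge 0$ an integer, and let $T_k=\frac{k(k+1)}{2}$. If $n+2T_k=ab$ with $a>k$ and $b>k$, then $n=\langle a-k,\, b-k,\, k+1\rangle$.
   Context: Natural numbers start at $1$. Let $\omega=e^{i\pi/3}$ and $\Lambda=\{m+n\omega : m,n\in\mathbb{Z}\}\subset\mathbb{C}$ the hexagonal lattice. For natural numbers $a,b,c$, the ternary product $\langle a,b,c\rangle$ is the number of points of $\Lambda$ in the closed (possibly degenerate) equiangular lattice hexagon with vertices $0$, $(a-1)$, $(a-1)+(b-1)\omega$, $(a-1)+(b-1)\omega+(c-1)\omega^2$, $(b-1)\omega+(c-1)\omega^2$, $(c-1)\omega^2$, i.e. the hexagon whose consecutive sides are parallel to $1,\omega,\omega^2,-1,-\omega,-\omega^2$ and contain $a,b,c,a,b,c$ lattice points. (Equivalently, $\langle a,b,c\rangle=ab+bc+ca-a-b-c+1$.) -}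

module Defs where

open import Data.Nat using (ℕ; suc; _+_; _*_; _∸_; _/_)

-- Ternary product ⟨a,b,c⟩ = ab + bc + ca - a - b - c + 1 (for a,b,c ≥ 1 this is
-- the number of hexagonal lattice points in the equiangular hexagon with side
-- lattice-point counts a,b,c,a,b,c). Written as (ab+bc+ca+1) ∸ (a+b+c),
-- which is exact (no truncation) whenever a,b,c ≥ 1.
⟨_,_,_⟩ : ℕ → ℕ → ℕ → ℕ
⟨ a , b , c ⟩ = (a * b + b * c + c * a + 1) ∸ (a + b + c)

T : ℕ → ℕ
T k = (k * suc k) / 2

{-# OPTIONS --safe #-}
module Submission where

open import Defs
open import Data.Nat using (ℕ; zero; suc; _+_; _*_; _∸_; _<_; _≤_)
open import Data.Nat.Properties
  using (+-∸-assoc; m+n∸m≡n; m+n∸n≡m; m≤m+n; +-cancelʳ-≡; m≤n⇒∃[o]m+o≡n)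
open import Data.Nat.Divisibility using (_∣_; _∣0; ∣m∣n⇒∣m+n; m∣m*n)
open import Data.Nat.DivMod using (m*[n/m]≡n)
open import Data.Nat.Tactic.RingSolver using (solve-∀)
open import Data.Product using (_,_)
open import Relation.Binary.PropositionalEquality
  using (_≡_; refl; sym; cong; cong₂; subst; module ≡-Reasoning)

-- Cutting two corner triangles of T k points each off an a × b lattice
-- parallelogram leaves the hexagon ⟨a−k, b−k, k+1⟩. Algebraically: writing
-- a = (k+1) + x and b = (k+1) + y, the truncated subtraction in ⟨_,_,_⟩ is exact,
-- and ⟨x+1, y+1, k+1⟩ + k(k+1) = ab is a polynomial identity in x, y, k.

2∣n*[1+n] : ∀ n → 2 ∣ n * suc n
2∣n*[1+n] zero    = 2 ∣0
2∣n*[1+n] (suc n) =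
  subst (2 ∣_) (step n) (∣m∣n⇒∣m+n (2∣n*[1+n] n) (m∣m*n (suc n)))
  where
  step : ∀ n → n * suc n + 2 * suc n ≡ suc n * suc (suc n)
  step = solve-∀

2*T≡n*[1+n] : ∀ n → 2 * T n ≡ n * suc n
2*T≡n*[1+n] n = m*[n/m]≡n (2∣n*[1+n] n)

[1+m+n]∸m≡1+n : ∀ m n → suc m + n ∸ m ≡ suc n
[1+m+n]∸m≡1+n m n = begin
  1 + (m + n) ∸ m  ≡⟨ +-∸-assoc 1 (m≤m+n m n) ⟩
  1 + (m + n ∸ m)  ≡⟨ cong suc (m+n∸m≡n m n) ⟩
  suc n            ∎
  where open ≡-Reasoning

⟨1+x,1+y,1+z⟩≡xy+yz+zx+x+y+z+1 : ∀ x y z →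
  ⟨ suc x , suc y , suc z ⟩ ≡ x * y + y * z + z * x + x + y + z + 1
⟨1+x,1+y,1+z⟩≡xy+yz+zx+x+y+z+1 x y z = begin
  suc x * suc y + suc y * suc z + suc z * suc x + 1 ∸ perimeter
    ≡⟨ cong (_∸ perimeter) (expand x y z) ⟩
  x * y + y * z + z * x + x + y + z + 1 + perimeter ∸ perimeter
    ≡⟨ m+n∸n≡m _ perimeter ⟩
  x * y + y * z + z * x + x + y + z + 1 ∎
  where
  open ≡-Reasoning
  perimeter : ℕ
  perimeter = suc x + suc y + suc z
  expand : ∀ x y z →
    suc x * suc y + suc y * suc z + suc z * suc x + 1
      ≡ x * y + y * z + z * x + x + y + z + 1 + (suc x + suc y + suc z)
  expand = solve-∀

⟨a∸k,b∸k,1+k⟩+k*[1+k]≡a*b : ∀ {a b k} → k < a → k < b →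
  ⟨ a ∸ k , b ∸ k , suc k ⟩ + k * suc k ≡ a * b
⟨a∸k,b∸k,1+k⟩+k*[1+k]≡a*b {k = k} k<a k<b
  with x , refl ← m≤n⇒∃[o]m+o≡n k<a
     | y , refl ← m≤n⇒∃[o]m+o≡n k<b = begin
  ⟨ suc k + x ∸ k , suc k + y ∸ k , suc k ⟩ + k * suc k
    ≡⟨ cong₂ (λ a′ b′ → ⟨ a′ , b′ , suc k ⟩ + k * suc k)
             ([1+m+n]∸m≡1+n k x) ([1+m+n]∸m≡1+n k y) ⟩
  ⟨ suc x , suc y , suc k ⟩ + k * suc k
    ≡⟨ cong (_+ k * suc k) (⟨1+x,1+y,1+z⟩≡xy+yz+zx+x+y+z+1 x y k) ⟩
  x * y + y * k + k * x + x + y + k + 1 + k * suc k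
    ≡⟨ rectangle x y k ⟩
  (suc k + x) * (suc k + y) ∎
  where
  open ≡-Reasoning
  rectangle : ∀ x y k →
    x * y + y * k + k * x + x + y + k + 1 + k * suc k ≡ (suc k + x) * (suc k + y)
  rectangle = solve-∀

mainTheorem6 : (n a b k : ℕ) → 1 ≤ n → 1 ≤ a → 1 ≤ b →
    n + 2 * T k ≡ a * b → k < a → k < b →
    n ≡ ⟨ a ∸ k , b ∸ k , suc k ⟩
mainTheorem6 n a b k _ _ _ n+2T≡ab k<a k<b = +-cancelʳ-≡ (k * suc k) n _ (begin
  n + k * suc k                           ≡⟨ cong (n +_) (sym (2*T≡n*[1+n] k)) ⟩
  n + 2 * T k                             ≡⟨ n+2T≡ab ⟩
  a * b                                   ≡⟨ sym (⟨a∸k,b∸k,1+k⟩+k*[1+k]≡a*b k<a k<b) ⟩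
  ⟨ a ∸ k , b ∸ k , suc k ⟩ + k * suc k  ∎)
  where open ≡-Reasoning
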